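{- For each property $P$ among prefix-convex, suffix-convex, factor-convex, subword-convex, prefix-closed, suffix-closed, factor-closed, subword-closed, there exists a family of NFAs $(M_n)$, where $M_n$ has $O(n)$ states and $L(M_n)$ does not have property $P$, such that the shortest witness to the failure of $P$ for $L(M_n)$ has length $2^{\Omega(n)}$.
   Context: Relations on words: $v$ is a prefix of $w$ if $w = vx$; a suffix if $w = xv$; a factor if $w = xvy$; a subword if $v$ is obtained from $w$ by deleting some not necessarily contiguous letters. For such a relation $\unlhd$: $L$ is $\unlhd$-convex if $u,w \in L$ and $u \unlhd v \unlhd w$ imply $v \in L$, and a witness to its failure is a triple $(u,v,w)$ with $u,w\in L$, $v \notin L$, $u \unlhd v \unlhd w$; $L$ is $\unlhd$-closed if $w \in L$ and $v \unlhd w$ imply $v \in L$, and a witness to its failure is a pair $(v,w)$ with $w \in L$, $v\notin L$, $v \unlhd w$. The length (size) of a witness is $|w|$. -}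

module Defs where

open import Data.Nat using (ℕ; _^_; _/_; _*_; _≤_; suc)
open import Data.Fin using (Fin)
open import Data.Bool using (Bool; true)
open import Data.List using (List; []; _∷_; _++_; length)
open import Data.List.Relation.Binary.Sublist.Propositional using (_⊆_)
open import Data.Product using (Σ; ∃; _×_)
open import Relation.Binary.PropositionalEquality using (_≡_)
open import Relation.Nullary using (¬_)

Word : ℕ → Set
Word k = List (Fin k)

Lang : ℕ → Set₁
Lang k = Word k → Set

record NFA (k : ℕ) : Set where
  field
    states : ℕ
    start  : Fin states
    δ      : Fin states → Fin k → Fin states → Bool
    final  : Fin states → Bool
open NFA public

data Run {k : ℕ} (M : NFA k) : Fin (states M) → Word k → Fin (states M) → Set where
  done : ∀ {q} → Run M q [] q
  step : ∀ {q a q' w q''} → δ M q a q' ≡ true → Run M q' w q'' → Run M q (a ∷ w) q''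

L : ∀ {k} → NFA k → Lang k
L M w = ∃ λ q → Run M (start M) w q × final M q ≡ true

data Relation : Set where
  prefix suffix factor subword : Relation

_⟨_⟩_ : ∀ {k} → Word k → Relation → Word k → Set
v ⟨ prefix ⟩ w = ∃ λ x → w ≡ v ++ x
v ⟨ suffix ⟩ w = ∃ λ x → w ≡ x ++ v
v ⟨ factor ⟩ w = Σ _ λ x → ∃ λ y → w ≡ x ++ (v ++ y)
v ⟨ subword ⟩ w = v ⊆ w

data Property : Set where
  convex : Relation → Property
  closed : Relation → Property

Has : ∀ {k} → Property → Lang k → Set
Has (convex R) Lang' = ∀ u v w → Lang' u → Lang' w → u ⟨ R ⟩ v → v ⟨ R ⟩ w → Lang' v
Has (closed R) Lang' = ∀ v w → Lang' w → v ⟨ R ⟩ w → Lang' v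

-- WitnessWithTop P L w : there is a witness to the failure of P for L
-- whose largest component is w (so its length is length w).
WitnessWithTop : ∀ {k} → Property → Lang k → Word k → Set
WitnessWithTop (convex R) Lang' w =
  Σ _ λ u → ∃ λ v → Lang' u × Lang' w × ¬ Lang' v × u ⟨ R ⟩ v × v ⟨ R ⟩ w
WitnessWithTop (closed R) Lang' w =
  ∃ λ v → Lang' w × ¬ Lang' v × v ⟨ R ⟩ w

-- Let n = m + 1. The counter word lists the n binary digits of 0, 1, 2, … block after block, least
-- significant digit first; each letter also records whether it is the last digit of its block and the
-- carry flowing into its digit. Then every letter is determined by its predecessor (which fixes the carry)
-- and by the letter n positions earlier (which fixes the flag and the digit). The NFA accepts exactly the
-- words showing a defect: a wrong first block, a violation of one of these two rules, or a last letter
-- other than (last, 1, carry 1); each defect is guessed and checked with O(n) states. A non-member is thus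
-- a prefix of the counter word ending at the top digit of the block 1…1, so it has length at least 2^n, and
-- so does every witness, as it lies above a non-member. The counter word up to that block is a non-member
-- w with [], wz and zw accepted, which breaks all eight properties.

module Submission where

open import Defs
open import Data.Bool using (Bool; true; false; not; _∧_; _∨_; _xor_)
open import Data.Bool.Properties using (T-≡; ∧-zeroʳ) renaming (_≟_ to _≟ᵇ_)
open import Data.Empty using (⊥-elim)
open import Data.Fin using (Fin; zero; suc; toℕ; fromℕ; fromℕ<; inject₁)
open import Data.Fin.Properties
  using (toℕ<n; toℕ-fromℕ; toℕ-fromℕ<; toℕ-inject₁; +↔⊎; *↔×; 1↔⊤; 2↔Bool) renaming (_≟_ to _≟ᶠ_)
open import Data.List using ([]; _∷_; _++_; length)
open import Data.List.Properties
  using (length-++-≤ˡ; length-++-≤ʳ; ++-assoc; ++-identityʳ; ∷-injective; ∷-injectiveˡ; ∷-injectiveʳ; ∷ʳ-injectiveʳ)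
open import Data.List.Relation.Binary.Sublist.Propositional using (⊆-refl; minimum)
open import Data.List.Relation.Binary.Sublist.Propositional.Properties using (length-mono-≤; ++⁺ʳ)
open import Data.Nat using (ℕ; zero; suc; pred; _+_; _*_; _^_; _/_; _≤_; _<_; ⌊_/2⌋; z≤n; s≤s; s<s⁻¹)
open import Data.Nat.DivMod using (n/1≡n)
open import Data.Nat.Properties
  using (_≟_; suc-injective; +-suc; +-identityʳ; +-comm; *-suc; ≤-refl; ≤-trans; ≤-reflexive; <-irrefl;
         n≤1+n; m≤m+n; +-monoʳ-≤; *-monoʳ-≤; n≡⌊n+n/2⌋; module ≤-Reasoning)
open import Data.Nat.Tactic.RingSolver using (solve-∀)
open import Data.Product using (Σ; ∃; ∃₂; _×_; _,_; proj₁; proj₂)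
open import Data.Product.Function.NonDependent.Propositional using (_×-↔_)
open import Data.Sum using (_⊎_; inj₁; inj₂)
import Data.Sum as Sum
open import Data.Sum.Function.Propositional using (_⊎-↔_)
open import Data.Unit using (⊤; tt)
open import Function using (_∘_; _↔_; Inverse; Equivalence)
open import Function.Properties.Inverse using (↔-refl; ↔-sym; ↔-trans)
open import Relation.Binary.PropositionalEquality
  using (_≡_; _≢_; refl; sym; trans; cong; cong₂; subst; subst₂; module ≡-Reasoning)
open import Relation.Nullary using (¬_; Dec; yes; no; does; ¬?)
open import Relation.Nullary.Decidable
  using (isYes; toWitness; fromWitness; dec-true; dec-false; decidable-stable; map′; _×-dec_)

module _ {k : ℕ} where

  ⟨⟩-length-≤ : ∀ R {v w : Word k} → v ⟨ R ⟩ w → length v ≤ length w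
  ⟨⟩-length-≤ prefix  {v} (x , refl)     = length-++-≤ˡ v
  ⟨⟩-length-≤ suffix  {v} (x , refl)     = length-++-≤ʳ v {x}
  ⟨⟩-length-≤ factor  {v} (x , y , refl) = ≤-trans (length-++-≤ˡ v) (length-++-≤ʳ (v ++ y) {x})
  ⟨⟩-length-≤ subword v⊆w                = length-mono-≤ v⊆w

  ¬Has-if-flanked : ∀ {Lg : Lang k} {w z} → Lg [] → Lg (w ++ z ∷ []) → Lg (z ∷ w) → ¬ Lg w →
                    ∀ P → ¬ Has P Lg
  ¬Has-if-flanked {w = w} {z} _   wz∈ _   w∉ (closed prefix)  has = w∉ (has w _ wz∈ (z ∷ [] , refl))
  ¬Has-if-flanked {w = w} {z} _   _   zw∈ w∉ (closed suffix)  has = w∉ (has w _ zw∈ (z ∷ [] , refl))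
  ¬Has-if-flanked {w = w} {z} _   wz∈ _   w∉ (closed factor)  has = w∉ (has w _ wz∈ ([] , z ∷ [] , refl))
  ¬Has-if-flanked {w = w} {z} _   wz∈ _   w∉ (closed subword) has = w∉ (has w _ wz∈ (++⁺ʳ (z ∷ []) ⊆-refl))
  ¬Has-if-flanked {w = w} {z} []∈ wz∈ _   w∉ (convex prefix)  has =
    w∉ (has [] w _ []∈ wz∈ (w , refl) (z ∷ [] , refl))
  ¬Has-if-flanked {w = w} {z} []∈ _   zw∈ w∉ (convex suffix)  has =
    w∉ (has [] w _ []∈ zw∈ (w , sym (++-identityʳ w)) (z ∷ [] , refl))
  ¬Has-if-flanked {w = w} {z} []∈ wz∈ _   w∉ (convex factor)  has =
    w∉ (has [] w _ []∈ wz∈ ([] , w , refl) ([] , z ∷ [] , refl))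
  ¬Has-if-flanked {w = w} {z} []∈ wz∈ _   w∉ (convex subword) has =
    w∉ (has [] w _ []∈ wz∈ (minimum w) (++⁺ʳ (z ∷ []) ⊆-refl))

  witness-length-≥ : ∀ {Lg : Lang k} {B} → (∀ v → ¬ Lg v → B ≤ length v) →
                     ∀ P w → WitnessWithTop P Lg w → B ≤ length w
  witness-length-≥ long (convex R) w (_ , v , _ , _ , v∉ , _ , v⊴w) = ≤-trans (long v v∉) (⟨⟩-length-≤ R v⊴w)
  witness-length-≥ long (closed R) w (v , _ , v∉ , v⊴w)             = ≤-trans (long v v∉) (⟨⟩-length-≤ R v⊴w)

-- Binary counting

odd : ℕ → Bool
odd zero          = false
odd (suc zero)    = true
odd (suc (suc k)) = odd k

bit : ℕ → ℕ → Bool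
bit k zero    = odd k
bit k (suc j) = bit ⌊ k /2⌋ j

-- carry k j: the j lowest binary digits of k are all 1, i.e. adding 1 to k carries into digit j.
carry : ℕ → ℕ → Bool
carry k zero    = true
carry k (suc j) = odd k ∧ carry ⌊ k /2⌋ j

odd-suc : ∀ k → odd (suc k) ≡ not (odd k)
odd-suc zero          = refl
odd-suc (suc zero)    = refl
odd-suc (suc (suc k)) = odd-suc k

⌊suc/2⌋-odd : ∀ k → odd k ≡ true → ⌊ suc k /2⌋ ≡ suc ⌊ k /2⌋
⌊suc/2⌋-odd (suc zero)    _ = refl
⌊suc/2⌋-odd (suc (suc k)) e = cong suc (⌊suc/2⌋-odd k e)

⌊suc/2⌋-even : ∀ k → odd k ≡ false → ⌊ suc k /2⌋ ≡ ⌊ k /2⌋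
⌊suc/2⌋-even zero          _ = refl
⌊suc/2⌋-even (suc (suc k)) e = cong suc (⌊suc/2⌋-even k e)

odd⇒suc≡2*suc⌊/2⌋ : ∀ k → odd k ≡ true → suc k ≡ 2 * suc ⌊ k /2⌋
odd⇒suc≡2*suc⌊/2⌋ (suc zero)    _ = refl
odd⇒suc≡2*suc⌊/2⌋ (suc (suc k)) e =
  trans (cong (2 +_) (odd⇒suc≡2*suc⌊/2⌋ k e)) (sym (*-suc 2 (suc ⌊ k /2⌋)))

carry-suc : ∀ k j → carry k (suc j) ≡ bit k j ∧ carry k j
carry-suc k zero    = refl
carry-suc k (suc j) with odd k
... | true  = carry-suc ⌊ k /2⌋ j
... | false = sym (∧-zeroʳ (bit ⌊ k /2⌋ j))

bit-suc : ∀ k j → bit (suc k) j ≡ carry k j xor bit k j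
bit-suc k zero    = odd-suc k
bit-suc k (suc j) with odd k in e
... | true  = trans (cong (λ h → bit h j) (⌊suc/2⌋-odd k e)) (bit-suc ⌊ k /2⌋ j)
... | false = cong (λ h → bit h j) (⌊suc/2⌋-even k e)

carry⇒2^≤suc : ∀ k j → carry k j ≡ true → 2 ^ j ≤ suc k
carry⇒2^≤suc k zero    _ = s≤s z≤n
carry⇒2^≤suc k (suc j) e with odd k in o
... | true = ≤-trans (*-monoʳ-≤ 2 (carry⇒2^≤suc ⌊ k /2⌋ j e))
                     (≤-reflexive (sym (odd⇒suc≡2*suc⌊/2⌋ k o)))

∧-true : ∀ {x y} → x ∧ y ≡ true → x ≡ true × y ≡ true
∧-true {true} {true} _ = refl , refl

allOnes : ℕ → ℕ
allOnes zero    = zero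
allOnes (suc r) = suc (allOnes r + allOnes r)

odd-double : ∀ x → odd (x + x) ≡ false
odd-double zero    = refl
odd-double (suc x) = trans (cong odd (+-suc (suc x) x)) (odd-double x)

⌊suc[x+x]/2⌋ : ∀ x → ⌊ suc (x + x) /2⌋ ≡ x
⌊suc[x+x]/2⌋ x = trans (⌊suc/2⌋-even (x + x) (odd-double x)) (sym (n≡⌊n+n/2⌋ x))

carry-allOnes : ∀ r → carry (allOnes r) r ≡ true
carry-allOnes zero    = refl
carry-allOnes (suc r)
  rewrite odd-suc (allOnes r + allOnes r) | odd-double (allOnes r) | ⌊suc[x+x]/2⌋ (allOnes r) = carry-allOnes r

record DecAutomaton (k : ℕ) : Set₁ where
  field
    State      : Set
    initial    : State
    Step       : State → Fin k → State → Set
    step?      : ∀ q a q' → Dec (Step q a q')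
    Accepting  : State → Set
    accepting? : ∀ q → Dec (Accepting q)

module _ {k : ℕ} (A : DecAutomaton k) where
  open DecAutomaton A

  data Path : State → Word k → State → Set where
    []  : ∀ {q} → Path q [] q
    _∷_ : ∀ {q a q' w q''} → Step q a q' → Path q' w q'' → Path q (a ∷ w) q''

  Accepts : Lang k
  Accepts w = ∃ λ q → Path initial w q × Accepting q

  module _ {N : ℕ} (enum : State ↔ Fin N) where
    open Inverse enum using (to; from; strictlyInverseʳ)

    toNFA : NFA k
    toNFA = record
      { states = N
      ; start  = to initial
      ; δ      = λ q a q' → isYes (step? (from q) a (from q'))
      ; final  = λ q → isYes (accepting? (from q))
      }

    private
      yes⇒ : ∀ {P : Set} {P? : Dec P} → isYes P? ≡ true → P
      yes⇒ e = toWitness (Equivalence.from T-≡ e)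

      ⇒yes : ∀ {P : Set} {P? : Dec P} → P → isYes P? ≡ true
      ⇒yes p = Equivalence.to T-≡ (fromWitness p)

      run⇒path : ∀ {q w q'} → Run toNFA q w q' → Path (from q) w (from q')
      run⇒path done       = []
      run⇒path (step s r) = yes⇒ s ∷ run⇒path r

      path⇒run : ∀ {q w q'} → Path q w q' → Run toNFA (to q) w (to q')
      path⇒run []                     = done
      path⇒run (_∷_ {q} {a} {q'} s p) =
        step (⇒yes (subst₂ (λ x y → Step x a y) (sym (strictlyInverseʳ q)) (sym (strictlyInverseʳ q')) s))
             (path⇒run p)

    L⇒Accepts : ∀ {w} → L toNFA w → Accepts w
    L⇒Accepts (q , r , f) = from q , subst (λ s → Path s _ (from q)) (strictlyInverseʳ initial) (run⇒path r) , yes⇒ f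

    Accepts⇒L : ∀ {w} → Accepts w → L toNFA w
    Accepts⇒L (q , p , f) = to q , path⇒run p , ⇒yes (subst Accepting (sym (strictlyInverseʳ q)) f)

-- The counter word

Letter : Set
Letter = Fin 8

-- Opaque, so that the encoding of letters as elements of Fin 8 never unfolds in goals.
opaque
  letters : Letter ↔ (Bool × Bool × Bool)
  letters = ↔-trans (*↔× {2} {4}) (2↔Bool ×-↔ ↔-trans (*↔× {2} {2}) (2↔Bool ×-↔ 2↔Bool))

  fields : Letter → Bool × Bool × Bool
  fields = Inverse.to letters

  letter : Bool → Bool → Bool → Letter
  letter l d c = Inverse.from letters (l , d , c)

  fields-letter : ∀ l d c → fields (letter l d c) ≡ (l , d , c)
  fields-letter l d c = Inverse.strictlyInverseˡ letters (l , d , c)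

  fields-injective : ∀ {a b} → fields a ≡ fields b → a ≡ b
  fields-injective {a} {b} e = begin
    a                                ≡⟨ Inverse.strictlyInverseʳ letters a ⟨
    Inverse.from letters (fields a)  ≡⟨ cong (Inverse.from letters) e ⟩
    Inverse.from letters (fields b)  ≡⟨ Inverse.strictlyInverseʳ letters b ⟩
    b                                ∎
    where open ≡-Reasoning

isLast digit carryIn : Letter → Bool
isLast  a = proj₁ (fields a)
digit   a = proj₁ (proj₂ (fields a))
carryIn a = proj₂ (proj₂ (fields a))

letter-≡ : ∀ {a b} → isLast a ≡ isLast b → digit a ≡ digit b → carryIn a ≡ carryIn b → a ≡ b
letter-≡ l d c = fields-injective (cong₂ _,_ l (cong₂ _,_ d c))

blank : Letter
blank = letter false false false

blank≢ : ∀ {a} → carryIn a ≡ true → blank ≢ a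
blank≢ c refl with () ← trans (sym (cong (proj₂ ∘ proj₂) (fields-letter false false false))) c

top : Letter
top = letter true true true

fields-top : ∀ {a} → a ≡ top → fields a ≡ (true , true , true)
fields-top e = trans (cong fields e) (fields-letter true true true)

module Counter (m : ℕ) where

  n : ℕ
  n = suc m

  -- Position i of the counter word is digit j of block k, where coord i = (k , j).
  advance : ℕ × ℕ → ℕ × ℕ
  advance (k , j) with j ≟ m
  ... | yes _ = suc k , zero
  ... | no  _ = k , suc j

  coord : ℕ → ℕ × ℕ
  coord zero    = zero , zero
  coord (suc i) = advance (coord i)

  nextBlock : ℕ × ℕ → ℕ × ℕ
  nextBlock (k , j) = suc k , j

  advance-nextBlock : ∀ p → advance (nextBlock p) ≡ nextBlock (advance p)
  advance-nextBlock (k , j) with j ≟ m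
  ... | yes _ = refl
  ... | no  _ = refl

  coord-< : ∀ j → j < n → coord j ≡ (zero , j)
  coord-< zero    _ = refl
  coord-< (suc j) (s≤s j<m) rewrite coord-< j (≤-trans (n≤1+n _) (s≤s j<m)) with j ≟ m
  ... | yes refl = ⊥-elim (<-irrefl refl j<m)
  ... | no  _    = refl

  coord-+n : ∀ i → coord (i + n) ≡ nextBlock (coord i)
  coord-+n zero    rewrite coord-< m ≤-refl with m ≟ m
  ... | yes _  = refl
  ... | no m≢m = ⊥-elim (m≢m refl)
  coord-+n (suc i) = trans (cong advance (coord-+n i)) (advance-nextBlock (coord i))

  block-≤ : ∀ i → proj₁ (coord i) ≤ i
  block-≤ zero    = z≤n
  block-≤ (suc i) with coord i | block-≤ i
  ... | k , j | k≤i with j ≟ m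
  ... | yes _ = s≤s k≤i
  ... | no  _ = ≤-trans k≤i (n≤1+n i)

  blockEnd : ℕ → ℕ
  blockEnd zero    = m
  blockEnd (suc k) = blockEnd k + n

  coord-blockEnd : ∀ k → coord (blockEnd k) ≡ (k , m)
  coord-blockEnd zero    = coord-< m ≤-refl
  coord-blockEnd (suc k) = trans (coord-+n (blockEnd k)) (cong nextBlock (coord-blockEnd k))

  m≤blockEnd : ∀ k → m ≤ blockEnd k
  m≤blockEnd zero    = ≤-refl
  m≤blockEnd (suc k) = ≤-trans (m≤blockEnd k) (m≤m+n (blockEnd k) n)

  letterAt : ℕ × ℕ → Letter
  letterAt (k , j) = letter (does (j ≟ m)) (bit k j) (carry k j)

  counter : ℕ → Letter
  counter i = letterAt (coord i)

  nextCarry : Letter → Bool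
  nextCarry a = isLast a ∨ (digit a ∧ carryIn a)

  Follows : Letter → Letter → Set
  Follows a b = isLast b ≡ isLast a × digit b ≡ carryIn a xor digit a

  fields-letterAt : ∀ k j → fields (letterAt (k , j)) ≡ (does (j ≟ m) , bit k j , carry k j)
  fields-letterAt k j = fields-letter _ _ _

  carryIn-advance : ∀ p → carryIn (letterAt (advance p)) ≡ nextCarry (letterAt p)
  carryIn-advance (k , j) rewrite fields-letterAt k j with j ≟ m
  ... | yes j≡m rewrite fields-letterAt (suc k) zero | dec-true (j ≟ m) j≡m = refl
  ... | no  j≢m rewrite fields-letterAt k (suc j) | dec-false (j ≟ m) j≢m = carry-suc k j

  counter-carryIn : ∀ i → carryIn (counter (suc i)) ≡ nextCarry (counter i)
  counter-carryIn i = carryIn-advance (coord i)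

  follows-nextBlock : ∀ p → Follows (letterAt p) (letterAt (nextBlock p))
  follows-nextBlock (k , j) rewrite fields-letterAt k j | fields-letterAt (suc k) j = refl , bit-suc k j

  counter-follows : ∀ i → Follows (counter i) (counter (i + n))
  counter-follows i rewrite coord-+n i = follows-nextBlock (coord i)

  letterAt-top : ∀ k j → letterAt (k , j) ≡ top → 2 ^ n ≤ suc k
  letterAt-top k j e with j ≟ m | trans (sym (fields-letterAt k j)) (fields-top e)
  ... | yes refl | eqs =
    carry⇒2^≤suc k n (trans (carry-suc k m) (cong₂ _∧_ (cong (proj₁ ∘ proj₂) eqs) (cong (proj₂ ∘ proj₂) eqs)))
  ... | no j≢m   | eqs with () ← trans (sym (dec-false (j ≟ m) j≢m)) (cong proj₁ eqs)

  counter-top : ∀ i → counter i ≡ top → 2 ^ n ≤ suc i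
  counter-top i e with coord i | block-≤ i
  ... | k , j | k≤i = ≤-trans (letterAt-top k j e) (s≤s k≤i)

  counter-blockEnd-top : counter (blockEnd (allOnes n)) ≡ top
  counter-blockEnd-top rewrite coord-blockEnd (allOnes n) =
    fields-injective (trans (fields-letterAt K m) (trans components (sym (fields-letter true true true))))
    where
    K : ℕ
    K = allOnes n
    digit∧carry : bit K m ≡ true × carry K m ≡ true
    digit∧carry = ∧-true (trans (sym (carry-suc K m)) (carry-allOnes n))
    components : (does (m ≟ m) , bit K m , carry K m) ≡ (true , true , true)
    components = cong₂ _,_ (dec-true (m ≟ m) refl) (cong₂ _,_ (proj₁ digit∧carry) (proj₂ digit∧carry))

  -- The letter n positions back fixes isLast and digit, the previous letter fixes carryIn.
  extension-unique : ∀ q {a} → Follows (counter q) a → carryIn a ≡ nextCarry (counter (q + m)) →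
                     a ≡ counter (q + n)
  extension-unique q (l , d) c with counter-follows q
  ... | l' , d' = letter-≡ (trans l (sym l')) (trans d (sym d'))
    (trans c (trans (sym (counter-carryIn (q + m))) (cong (carryIn ∘ counter) (sym (+-suc q m)))))

  segment : ℕ → ℕ → Word 8
  segment i zero    = []
  segment i (suc r) = counter i ∷ segment (suc i) r

  length-segment : ∀ i r → length (segment i r) ≡ r
  length-segment i zero    = refl
  length-segment i (suc r) = cong suc (length-segment (suc i) r)

  segment-++ : ∀ i r s → segment i (r + s) ≡ segment i r ++ segment (i + r) s
  segment-++ i zero    s = cong (λ t → segment t s) (sym (+-identityʳ i))
  segment-++ i (suc r) s = cong (counter i ∷_)
    (trans (segment-++ (suc i) r s) (cong (λ t → segment (suc i) r ++ segment t s) (sym (+-suc i r))))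

  segment-∷ʳ : ∀ i r → segment i (suc r) ≡ segment i r ++ counter (i + r) ∷ []
  segment-∷ʳ i r = trans (cong (segment i) (+-comm 1 r)) (segment-++ i r 1)

  segment-drop : ∀ i r x y → segment i r ≡ x ++ y → y ≡ segment (i + length x) (length y)
  segment-drop i r       []      y refl rewrite +-identityʳ i | length-segment i r = refl
  segment-drop i (suc r) (a ∷ x) y e    = trans (segment-drop (suc i) r x y (∷-injectiveʳ e))
    (cong (λ t → segment t (length y)) (sym (+-suc i (length x))))

  -- Deviates i v: v does not start with counter i, …, counter m (in particular, when it is too short).
  data Deviates : Fin n → Word 8 → Set where
    short    : ∀ {i} → Deviates i []
    mismatch : ∀ {i a v} → a ≢ counter (toℕ i) → Deviates i (a ∷ v)
    matches  : ∀ {i i' v} → toℕ i' ≡ suc (toℕ i) → Deviates i' v → Deviates i (counter (toℕ i) ∷ v)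

  LocalDefect DistanceDefect BadEnd : Word 8 → Set
  LocalDefect v    = ∃₂ λ x a → ∃₂ λ b y → v ≡ x ++ a ∷ b ∷ y × carryIn b ≢ nextCarry a
  DistanceDefect v = ∃₂ λ x a → ∃₂ λ y b → ∃ λ z →
                       v ≡ x ++ a ∷ y ++ b ∷ z × length y ≡ m × ¬ Follows a b
  BadEnd v         = ∃₂ λ x a → v ≡ x ++ a ∷ [] × a ≢ top

  Consistent : Word 8 → Set
  Consistent v = ¬ LocalDefect v × ¬ DistanceDefect v

  InnerDefect : Word 8 → Set
  InnerDefect v = LocalDefect v ⊎ DistanceDefect v ⊎ BadEnd v

  Defect : Word 8 → Set
  Defect v = Deviates zero v ⊎ InnerDefect v

  deviates-or-begins : ∀ (i : Fin n) k → toℕ i + k < n → ∀ v →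
                       Deviates i v ⊎ ∃ λ r → v ≡ segment (toℕ i) (suc k) ++ r
  deviates-or-begins i k i+k<n []      = inj₁ short
  deviates-or-begins i k i+k<n (a ∷ v) with a ≟ᶠ counter (toℕ i)
  ... | no a≢c = inj₁ (mismatch a≢c)
  deviates-or-begins i zero    i+k<n (_ ∷ v) | yes refl = inj₂ (v , refl)
  deviates-or-begins i (suc k) i+k<n (_ ∷ v) | yes refl =
    Sum.map (matches i'≡)
            (λ (r , e) → r , cong (counter (toℕ i) ∷_) (subst (λ t → v ≡ segment t (suc k) ++ r) i'≡ e))
      (deviates-or-begins i' k (subst (λ t → t + k < n) (sym i'≡) i+1+k<n) v)
    where
    i+1+k<n : suc (toℕ i) + k < n
    i+1+k<n = subst (_< n) (+-suc (toℕ i) k) i+k<n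
    i+1<n : suc (toℕ i) < n
    i+1<n = ≤-trans (s≤s (s≤s (m≤m+n (toℕ i) k))) i+1+k<n
    i' : Fin n
    i' = fromℕ< i+1<n
    i'≡ : toℕ i' ≡ suc (toℕ i)
    i'≡ = toℕ-fromℕ< i+1<n

  deviates-segment : ∀ {i v} r → Deviates i v → v ≡ segment (toℕ i) r → toℕ i + r < n
  deviates-segment {i} zero    _            _ = subst (_< n) (sym (+-identityʳ (toℕ i))) (toℕ<n i)
  deviates-segment     (suc r) short         ()
  deviates-segment     (suc r) (mismatch ne) e = ⊥-elim (ne (∷-injectiveˡ e))
  deviates-segment {i} (suc r) (matches {i' = i'} i'≡ d) e =
    subst (_< n) (trans (cong (_+ r) i'≡) (sym (+-suc (toℕ i) r)))
      (deviates-segment r d (trans (∷-injectiveʳ e) (cong (λ t → segment t r) (sym i'≡))))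

  consistent-prefix : ∀ u s → Consistent (u ++ s) → Consistent u
  consistent-prefix u s (¬local , ¬distance) =
    (λ (x , a , b , y , e , d) → ¬local (x , a , b , y ++ s , trans (cong (_++ s) e) (++-assoc x _ s) , d)) ,
    (λ (x , a , y , b , z , e , ly , d) → ¬distance (x , a , y , b , z ++ s ,
       trans (cong (_++ s) e) (trans (++-assoc x _ s) (cong (λ t → x ++ a ∷ t) (++-assoc y _ s))) , ly , d))

  segment-consistent : ∀ i r → Consistent (segment i r)
  segment-consistent i r = ¬local , ¬distance
    where
    ¬local : ¬ LocalDefect (segment i r)
    ¬local (x , a , b , y , e , d) with ∷-injective (segment-drop i r x _ e)
    ... | refl , e' with ∷-injective e'
    ... | refl , _ = d (counter-carryIn (i + length x))
    ¬distance : ¬ DistanceDefect (segment i r)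
    ¬distance (x , a , y , b , z , e , ly , d) with segment-drop i r x _ e
    ... | e' with segment-drop (suc (i + length x)) _ y (b ∷ z) (sym (∷-injectiveʳ e'))
    ... | e'' = d (subst₂ Follows (sym (∷-injectiveˡ e')) (sym (trans (∷-injectiveˡ e'') (cong counter position)))
                   (counter-follows (i + length x)))
      where
      position : suc (i + length x) + length y ≡ i + length x + n
      position = trans (cong (λ t → suc (i + length x + t)) ly) (sym (+-suc (i + length x) m))

  follows? : ∀ a b → Dec (Follows a b)
  follows? a b = (isLast b ≟ᵇ isLast a) ×-dec (digit b ≟ᵇ carryIn a xor digit a)

  consistent-extension : ∀ q a → Consistent (segment 0 (q + n) ++ a ∷ []) → a ≡ counter (q + n)
  consistent-extension q a (¬local , ¬distance) = extension-unique q follows carries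
    where
    at-distance : segment 0 (q + n) ++ a ∷ [] ≡ segment 0 q ++ counter q ∷ segment (suc q) m ++ a ∷ []
    at-distance = trans (cong (_++ a ∷ []) (segment-++ 0 q n)) (++-assoc (segment 0 q) (segment q n) (a ∷ []))
    follows : Follows (counter q) a
    follows = decidable-stable (follows? _ _) λ ¬f →
      ¬distance (segment 0 q , counter q , segment (suc q) m , a , [] , at-distance , length-segment (suc q) m , ¬f)
    adjacent : segment 0 (q + n) ++ a ∷ [] ≡ segment 0 (q + m) ++ counter (q + m) ∷ a ∷ []
    adjacent = trans (cong (λ t → segment 0 t ++ a ∷ []) (+-suc q m))
      (trans (cong (_++ a ∷ []) (segment-∷ʳ 0 (q + m))) (++-assoc (segment 0 (q + m)) _ _))
    carries : carryIn a ≡ nextCarry (counter (q + m))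
    carries = decidable-stable (carryIn a ≟ᵇ _) λ ¬c →
      ¬local (segment 0 (q + m) , counter (q + m) , a , [] , adjacent , ¬c)

  consistent-segment-++ : ∀ r q → Consistent (segment 0 (q + n) ++ r) →
                          segment 0 (q + n) ++ r ≡ segment 0 (q + n + length r)
  consistent-segment-++ []      q _ = trans (++-identityʳ _) (cong (segment 0) (sym (+-identityʳ _)))
  consistent-segment-++ (a ∷ r) q c =
    trans shift (trans (consistent-segment-++ r (suc q) (subst Consistent shift c))
                       (cong (segment 0) (sym (+-suc (q + n) (length r)))))
    where
    a≡ : a ≡ counter (q + n)
    a≡ = consistent-extension q a
           (consistent-prefix _ r (subst Consistent (sym (++-assoc (segment 0 (q + n)) (a ∷ []) r)) c))
    shift : segment 0 (q + n) ++ a ∷ r ≡ segment 0 (suc q + n) ++ r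
    shift = trans (sym (++-assoc (segment 0 (q + n)) (a ∷ []) r))
                  (cong (_++ r) (trans (cong (λ t → segment 0 (q + n) ++ t ∷ []) a≡) (sym (segment-∷ʳ 0 (q + n)))))

  defect-free⇒long : ∀ v → ¬ Defect v → 2 ^ n ≤ length v
  defect-free⇒long v ¬defect with deviates-or-begins zero m ≤-refl v
  ... | inj₁ d        = ⊥-elim (¬defect (inj₁ d))
  ... | inj₂ (r , refl) = subst (2 ^ n ≤_) length-v (counter-top t ends-top)
    where
    t : ℕ
    t = m + length r
    v≡ : segment 0 n ++ r ≡ segment 0 t ++ counter t ∷ []
    v≡ = trans (consistent-segment-++ r 0 (¬defect ∘ inj₂ ∘ inj₁ , ¬defect ∘ inj₂ ∘ inj₂ ∘ inj₁)) (segment-∷ʳ 0 t)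
    ends-top : counter t ≡ top
    ends-top = decidable-stable (counter t ≟ᶠ top) λ ne →
      ¬defect (inj₂ (inj₂ (inj₂ (segment 0 t , counter t , v≡ , ne))))
    length-v : suc t ≡ length (segment 0 n ++ r)
    length-v = sym (trans (cong length v≡) (trans (sym (cong length (segment-∷ʳ 0 t))) (length-segment 0 (suc t))))

  allOnesEnd : ℕ
  allOnesEnd = blockEnd (allOnes n)

  fullCounter : Word 8
  fullCounter = segment 0 (suc allOnesEnd)

  fullCounter-defect-free : ¬ Defect fullCounter
  fullCounter-defect-free (inj₁ d) =
    <-irrefl refl (≤-trans (s<s⁻¹ (deviates-segment (suc allOnesEnd) d refl)) (m≤blockEnd (allOnes n)))
  fullCounter-defect-free (inj₂ (inj₁ l)) = proj₁ (segment-consistent 0 _) l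
  fullCounter-defect-free (inj₂ (inj₂ (inj₁ d))) = proj₂ (segment-consistent 0 _) d
  fullCounter-defect-free (inj₂ (inj₂ (inj₂ (x , a , e , a≢top)))) =
    a≢top (trans (∷ʳ-injectiveʳ x (segment 0 allOnesEnd) (trans (sym e) (segment-∷ʳ 0 allOnesEnd)))
                 counter-blockEnd-top)

  deviates-blank : ∀ v → Deviates zero (blank ∷ v)
  deviates-blank v = mismatch (blank≢ (cong (proj₂ ∘ proj₂) (fields-letterAt 0 0)))

  badEnd-blank : ∀ v → BadEnd (v ++ blank ∷ [])
  badEnd-blank v = v , blank , refl , blank≢ (cong (proj₂ ∘ proj₂) (fields-letter true true true))

  -- The defect automaton

  State : Set
  State = Fin n ⊎ ⊤ ⊎ Letter ⊎ Letter × Fin n ⊎ Bool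

  -- A sum type, so that the number of states is read off from the library bijections below.
  pattern test i       = inj₁ i
  pattern scan         = inj₂ (inj₁ tt)
  pattern local a      = inj₂ (inj₂ (inj₁ a))
  pattern distance a j = inj₂ (inj₂ (inj₂ (inj₁ (a , j))))
  pattern ended        = inj₂ (inj₂ (inj₂ (inj₂ false)))
  pattern sink         = inj₂ (inj₂ (inj₂ (inj₂ true)))

  enumeration : State ↔ Fin (n + (1 + (8 + (8 * n + 2))))
  enumeration = ↔-sym (↔-trans +↔⊎ (↔-refl ⊎-↔ ↔-trans +↔⊎ (1↔⊤ ⊎-↔
                      ↔-trans +↔⊎ (↔-refl ⊎-↔ ↔-trans +↔⊎ (*↔× ⊎-↔ 2↔Bool)))))

  data ScanStep (a : Letter) : State → Set where
    stay           : ScanStep a scan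
    check-local    : ScanStep a (local a)
    check-distance : ScanStep a (distance a (fromℕ m))
    check-end      : a ≢ top → ScanStep a ended

  data Step : State → Letter → State → Set where
    test-match      : ∀ {i i'} → toℕ i' ≡ suc (toℕ i) → Step (test i) (counter (toℕ i)) (test i')
    test-mismatch   : ∀ {i a} → a ≢ counter (toℕ i) → Step (test i) a sink
    test-scan       : ∀ {a q} → ScanStep a q → Step (test zero) a q
    scan-step       : ∀ {a q} → ScanStep a q → Step scan a q
    local-reject    : ∀ {a b} → carryIn b ≢ nextCarry a → Step (local a) b sink
    distance-count  : ∀ {a b j} → Step (distance a (suc j)) b (distance a (inject₁ j))
    distance-reject : ∀ {a b} → ¬ Follows a b → Step (distance a zero) b sink
    sink-loop       : ∀ {a} → Step sink a sink

  data Accepting : State → Set where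
    at-test : ∀ {i} → Accepting (test i)
    at-end  : Accepting ended
    at-sink : Accepting sink

  scanStep? : ∀ a q → Dec (ScanStep a q)
  scanStep? a (test _) = no λ ()
  scanStep? a scan     = yes stay
  scanStep? a (local b) with a ≟ᶠ b
  ... | yes refl = yes check-local
  ... | no  a≢b  = no λ { check-local → a≢b refl }
  scanStep? a (distance b j) with a ≟ᶠ b | j ≟ᶠ fromℕ m
  ... | yes refl | yes refl = yes check-distance
  ... | no  a≢b  | _        = no λ { check-distance → a≢b refl }
  ... | _        | no  j≢m  = no λ { check-distance → j≢m refl }
  scanStep? a ended = map′ check-end (λ { (check-end a≢top) → a≢top }) (¬? (a ≟ᶠ top))
  scanStep? a sink  = no λ ()

  test-scan? : ∀ i a q → Dec (ScanStep a q) → (∀ {i'} → q ≢ test i') → q ≢ sink → Dec (Step (test i) a q)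
  test-scan? zero    a q (yes s) _ _ = yes (test-scan s)
  test-scan? zero    a q (no ¬s) ¬test ¬sink =
    no λ { (test-match _) → ¬test refl ; (test-mismatch _) → ¬sink refl ; (test-scan s) → ¬s s }
  test-scan? (suc i) a q _ ¬test ¬sink = no λ { (test-match _) → ¬test refl ; (test-mismatch _) → ¬sink refl }

  step? : ∀ q a q' → Dec (Step q a q')
  step? (test i) a (test i') with a ≟ᶠ counter (toℕ i) | toℕ i' ≟ suc (toℕ i)
  ... | yes refl | yes i'≡ = yes (test-match i'≡)
  ... | no  a≢c  | _       = no λ { (test-match _) → a≢c refl ; (test-scan ()) }
  ... | _        | no  i'≢ = no λ { (test-match i'≡) → i'≢ i'≡ ; (test-scan ()) }
  step? (test i) a sink =
    map′ test-mismatch (λ { (test-mismatch a≢c) → a≢c ; (test-scan ()) }) (¬? (a ≟ᶠ counter (toℕ i)))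
  step? (test i) a q@scan           = test-scan? i a q (scanStep? a q) (λ ()) (λ ())
  step? (test i) a q@(local _)      = test-scan? i a q (scanStep? a q) (λ ()) (λ ())
  step? (test i) a q@(distance _ _) = test-scan? i a q (scanStep? a q) (λ ()) (λ ())
  step? (test i) a q@ended          = test-scan? i a q (scanStep? a q) (λ ()) (λ ())
  step? scan a q = map′ scan-step (λ { (scan-step s) → s }) (scanStep? a q)
  step? (local a) b sink = map′ local-reject (λ { (local-reject d) → d }) (¬? (carryIn b ≟ᵇ nextCarry a))
  step? (local a) b (test _)       = no λ ()
  step? (local a) b scan           = no λ ()
  step? (local a) b (local _)      = no λ ()
  step? (local a) b (distance _ _) = no λ ()
  step? (local a) b ended          = no λ ()
  step? (distance a zero) b sink = map′ distance-reject (λ { (distance-reject d) → d }) (¬? (follows? a b))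
  step? (distance a (suc j)) b (distance a' j') with a' ≟ᶠ a | j' ≟ᶠ inject₁ j
  ... | yes refl | yes refl = yes distance-count
  ... | no  a'≢a | _        = no λ { distance-count → a'≢a refl }
  ... | _        | no  j'≢  = no λ { distance-count → j'≢ refl }
  step? (distance a zero)    b (distance _ _) = no λ ()
  step? (distance a (suc j)) b sink           = no λ ()
  step? (distance a j) b (test _)       = no λ ()
  step? (distance a j) b scan           = no λ ()
  step? (distance a j) b (local _)      = no λ ()
  step? (distance a j) b ended          = no λ ()
  step? ended a q = no λ ()
  step? sink a sink           = yes sink-loop
  step? sink a (test _)       = no λ ()
  step? sink a scan           = no λ ()
  step? sink a (local _)      = no λ ()
  step? sink a (distance _ _) = no λ ()
  step? sink a ended          = no λ ()

  accepting? : ∀ q → Dec (Accepting q)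
  accepting? (test _)       = yes at-test
  accepting? scan           = no λ ()
  accepting? (local _)      = no λ ()
  accepting? (distance _ _) = no λ ()
  accepting? ended          = yes at-end
  accepting? sink           = yes at-sink

  automaton : DecAutomaton 8
  automaton = record
    { State = State ; initial = test zero ; Step = Step ; step? = step?
    ; Accepting = Accepting ; accepting? = accepting? }

  innerDefect-∷ : ∀ {a v} → InnerDefect v → InnerDefect (a ∷ v)
  innerDefect-∷ {a} (inj₁ (x , b , c , y , refl , d))         = inj₁ (a ∷ x , b , c , y , refl , d)
  innerDefect-∷ {a} (inj₂ (inj₁ (x , b , y , c , z , refl , e))) = inj₂ (inj₁ (a ∷ x , b , y , c , z , refl , e))
  innerDefect-∷ {a} (inj₂ (inj₂ (x , b , refl , b≢top)))       = inj₂ (inj₂ (a ∷ x , b , refl , b≢top))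

  ended-path : ∀ {w q} → Path automaton ended w q → w ≡ []
  ended-path [] = refl

  local-path : ∀ {a w q} → Path automaton (local a) w q → Accepting q →
               ∃₂ λ b y → w ≡ b ∷ y × carryIn b ≢ nextCarry a
  local-path (local-reject d ∷ _) _ = _ , _ , refl , d

  distance-path : ∀ {a j w q} → Path automaton (distance a j) w q → Accepting q →
                  ∃₂ λ y b → ∃ λ z → w ≡ y ++ b ∷ z × length y ≡ toℕ j × ¬ Follows a b
  distance-path (distance-reject d ∷ _) _ = [] , _ , _ , refl , refl , d
  distance-path (distance-count {j = j} ∷ p) acc with distance-path p acc
  ... | y , b , z , refl , ly , d = _ ∷ y , b , z , refl , cong suc (trans ly (toℕ-inject₁ j)) , d

  scan-path : ∀ {w q} → Path automaton scan w q → Accepting q → InnerDefect w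
  scanStep-path : ∀ {a q w q'} → ScanStep a q → Path automaton q w q' → Accepting q' → InnerDefect (a ∷ w)

  scan-path (scan-step s ∷ p) acc = scanStep-path s p acc

  scanStep-path stay           p acc = innerDefect-∷ (scan-path p acc)
  scanStep-path check-local    p acc with local-path p acc
  ... | b , y , refl , d = inj₁ ([] , _ , b , y , refl , d)
  scanStep-path check-distance p acc with distance-path p acc
  ... | y , b , z , refl , ly , d = inj₂ (inj₁ ([] , _ , y , b , z , refl , trans ly (toℕ-fromℕ m) , d))
  scanStep-path (check-end a≢top) p acc with ended-path p
  ... | refl = inj₂ (inj₂ ([] , _ , refl , a≢top))

  test-path : ∀ {i w q} → Path automaton (test i) w q → Accepting q → Deviates i w ⊎ InnerDefect w
  test-path []                      at-test = inj₁ short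
  test-path (test-match i'≡ ∷ p)    acc     = Sum.map (matches i'≡) innerDefect-∷ (test-path p acc)
  test-path (test-mismatch a≢c ∷ _) _       = inj₁ (mismatch a≢c)
  test-path (test-scan s ∷ p)       acc     = inj₂ (scanStep-path s p acc)

  accepts⇒defect : ∀ {v} → Accepts automaton v → Defect v
  accepts⇒defect (_ , p , acc) = test-path p acc

  sink-path : ∀ w → Path automaton sink w sink
  sink-path []      = []
  sink-path (_ ∷ w) = sink-loop ∷ sink-path w

  scan-path-++ : ∀ x {w q} → Path automaton scan w q → Path automaton scan (x ++ w) q
  scan-path-++ []      p = p
  scan-path-++ (_ ∷ x) p = scan-step stay ∷ scan-path-++ x p

  start-path : ∀ x {a q w q'} → ScanStep a q → Path automaton q w q' → Path automaton (test zero) (x ++ a ∷ w) q'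
  start-path []      s p = test-scan s ∷ p
  start-path (_ ∷ x) s p = test-scan stay ∷ scan-path-++ x (scan-step s ∷ p)

  distance-path⁺ : ∀ {a b} (j : Fin n) y z → length y ≡ toℕ j → ¬ Follows a b →
                   Path automaton (distance a j) (y ++ b ∷ z) sink
  distance-path⁺ zero    []      z _  d = distance-reject d ∷ sink-path z
  distance-path⁺ (suc j) (_ ∷ y) z ly d =
    distance-count ∷ distance-path⁺ (inject₁ j) y z (trans (suc-injective ly) (sym (toℕ-inject₁ j))) d

  deviates⇒path : ∀ {i v} → Deviates i v → ∃ λ q → Path automaton (test i) v q × Accepting q
  deviates⇒path {i} short          = test i , [] , at-test
  deviates⇒path (mismatch a≢c)     = sink , test-mismatch a≢c ∷ sink-path _ , at-sink
  deviates⇒path (matches i'≡ d) with deviates⇒path d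
  ... | q , p , acc = q , test-match i'≡ ∷ p , acc

  defect⇒accepts : ∀ {v} → Defect v → Accepts automaton v
  defect⇒accepts (inj₁ d) = deviates⇒path d
  defect⇒accepts (inj₂ (inj₁ (x , a , b , y , refl , d))) =
    sink , start-path x check-local (local-reject d ∷ sink-path y) , at-sink
  defect⇒accepts (inj₂ (inj₂ (inj₁ (x , a , y , b , z , refl , ly , d)))) =
    sink , start-path x check-distance (distance-path⁺ (fromℕ m) y z (trans ly (sym (toℕ-fromℕ m))) d) , at-sink
  defect⇒accepts (inj₂ (inj₂ (inj₂ (x , a , refl , a≢top)))) =
    ended , start-path x (check-end a≢top) [] , at-end

  counterNFA : NFA 8
  counterNFA = toNFA automaton enumeration

  defect⇒member : ∀ {v} → Defect v → L counterNFA v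
  defect⇒member = Accepts⇒L automaton enumeration ∘ defect⇒accepts

  non-member-long : ∀ v → ¬ L counterNFA v → 2 ^ n ≤ length v
  non-member-long v v∉ = defect-free⇒long v (v∉ ∘ defect⇒member)

  fullCounter∉ : ¬ L counterNFA fullCounter
  fullCounter∉ = fullCounter-defect-free ∘ accepts⇒defect ∘ L⇒Accepts automaton enumeration

  ¬Has-counterNFA : ∀ P → ¬ Has P (L counterNFA)
  ¬Has-counterNFA = ¬Has-if-flanked (defect⇒member (inj₁ short))
                                    (defect⇒member (inj₂ (inj₂ (inj₂ (badEnd-blank fullCounter)))))
                                    (defect⇒member (inj₁ (deviates-blank fullCounter)))
                                    fullCounter∉

9n+11≤20n : ∀ n → 1 ≤ n → n + (1 + (8 + (8 * n + 2))) ≤ 20 * n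
9n+11≤20n n 1≤n = begin
  n + (1 + (8 + (8 * n + 2))) ≡⟨ lhs n ⟩
  9 * n + 11                  ≤⟨ +-monoʳ-≤ (9 * n) (*-monoʳ-≤ 11 1≤n) ⟩
  9 * n + 11 * n              ≡⟨ rhs n ⟩
  20 * n                      ∎
  where
  open ≤-Reasoning
  lhs : ∀ n → n + (1 + (8 + (8 * n + 2))) ≡ 9 * n + 11
  lhs = solve-∀
  rhs : ∀ n → 9 * n + 11 * n ≡ 20 * n
  rhs = solve-∀

counterFamily : ℕ → NFA 8
counterFamily n = Counter.counterNFA (pred n)

theorem17 : (P : Property) →
    Σ ℕ λ k → Σ (ℕ → NFA k) λ M → Σ ℕ λ c → Σ ℕ λ d → ∃ λ N →
      ∀ n → N ≤ n →
        (states (M n) ≤ c * n)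
        × ¬ Has P (L (M n))
        × (∀ w → WitnessWithTop P (L (M n)) w → 2 ^ (n / suc d) ≤ length w)
theorem17 P = 8 , counterFamily , 20 , 0 , 1 , bounds
  where
  bounds : ∀ n → 1 ≤ n → (states (counterFamily n) ≤ 20 * n) × ¬ Has P (L (counterFamily n))
           × (∀ w → WitnessWithTop P (L (counterFamily n)) w → 2 ^ (n / 1) ≤ length w)
  bounds (suc m) 1≤n = 9n+11≤20n (suc m) 1≤n , ¬Has-counterNFA P ,
    λ w witness → subst (λ e → 2 ^ e ≤ length w) (sym (n/1≡n (suc m))) (witness-length-≥ non-member-long P w witness)
    where open Counter m
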